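{- Let $t\ge1$ be an integer and let $H$ be a graph. If the class of $H$-free graphs is $(t-1)$-strongly Pollyanna, then the class of $(K_t\cup H)$-free graphs is $(t-1)$-strongly Pollyanna.
   Context: $K_t\cup H$ is the disjoint union of $K_t$ and $H$; $H$-free means no induced subgraph isomorphic to $H$. A class is polynomially $\chi$-bounded if there is a polynomial $f$ with $\chi(G')\le f(\omega(G'))$ for every induced subgraph $G'$ of every graph in the class. For an integer $n$, $\chi^{(n)}(G)$ is the maximum chromatic number of an induced subgraph $G'$ of $G$ with $\omega(G')\le n$. A class $\mathcal F$ is $n$-good if it is closed under induced subgraphs and there is a constant $c$ with $\chi^{(n)}(G)\le c$ for all $G\in\mathcal F$. A class $\mathcal C$ is $n$-strongly Pollyanna if $\mathcal C\cap\mathcal F$ is polynomially $\chi$-bounded for every $n$-good class $\mathcal F$. -}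

module Defs where

open import Data.Nat using (ℕ; zero; suc; _+_; _*_; _^_)
open import Data.Fin using (Fin; splitAt; _≟_)
open import Data.Bool using (Bool; true; false; not)
open import Data.Sum using (_⊎_; inj₁; inj₂)
open import Data.Product using (Σ; _×_; _,_; ∃)
open import Data.List using (List; []; _∷_)
open import Data.Empty using (⊥)
open import Relation.Nullary using (¬_; yes; no)
open import Relation.Binary.PropositionalEquality using (_≡_; refl; _≢_)
open import Function.Definitions using (Injective)

record Graph : Set where
  field
    size  : ℕ
    adj   : Fin size → Fin size → Bool
    sym   : ∀ i j → adj i j ≡ adj j i
    irrefl : ∀ i → adj i i ≡ false
open Graph public

-- Induced embedding of H into G: an injective vertex map preserving
-- adjacency and non-adjacency.  "H is (isomorphic to) an induced subgraph of G".
record Embeds (H G : Graph) : Set where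
  field
    map    : Fin (size H) → Fin (size G)
    inj    : Injective _≡_ _≡_ map
    presv  : ∀ i j → adj H i j ≡ adj G (map i) (map j)

Free : Graph → Graph → Set
Free H G = ¬ Embeds H G

K-adj : (t : ℕ) → Fin t → Fin t → Bool
K-adj t i j with i ≟ j
... | yes _ = false
... | no _  = true

K-sym : (t : ℕ) → ∀ i j → K-adj t i j ≡ K-adj t j i
K-sym t i j with i ≟ j | j ≟ i
... | yes _ | yes _ = refl
... | no _  | no _  = refl
... | yes p | no q = Data.Empty.⊥-elim (q (Relation.Binary.PropositionalEquality.sym p))
  where import Data.Empty
... | no p  | yes q = Data.Empty.⊥-elim (p (Relation.Binary.PropositionalEquality.sym q))
  where import Data.Empty

K-irrefl : (t : ℕ) → ∀ i → K-adj t i i ≡ false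
K-irrefl t i with i ≟ i
... | yes _ = refl
... | no p = Data.Empty.⊥-elim (p refl)
  where import Data.Empty

K : ℕ → Graph
K t = record { size = t ; adj = K-adj t ; sym = K-sym t ; irrefl = K-irrefl t }

∪-adj : (G H : Graph) → Fin (size G + size H) → Fin (size G + size H) → Bool
∪-adj G H i j with splitAt (size G) i | splitAt (size G) j
... | inj₁ a | inj₁ b = adj G a b
... | inj₂ a | inj₂ b = adj H a b
... | inj₁ _ | inj₂ _ = false
... | inj₂ _ | inj₁ _ = false

∪-sym : (G H : Graph) → ∀ i j → ∪-adj G H i j ≡ ∪-adj G H j i
∪-sym G H i j with splitAt (size G) i | splitAt (size G) j
... | inj₁ a | inj₁ b = sym G a b
... | inj₂ a | inj₂ b = sym H a b
... | inj₁ _ | inj₂ _ = refl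
... | inj₂ _ | inj₁ _ = refl

∪-irrefl : (G H : Graph) → ∀ i → ∪-adj G H i i ≡ false
∪-irrefl G H i with splitAt (size G) i
... | inj₁ a = irrefl G a
... | inj₂ a = irrefl H a

_∪G_ : Graph → Graph → Graph
G ∪G H = record { size = size G + size H ; adj = ∪-adj G H
                ; sym = ∪-sym G H ; irrefl = ∪-irrefl G H }

Colorable : Graph → ℕ → Set
Colorable G k = Σ (Fin (size G) → Fin k) λ c →
  ∀ i j → adj G i j ≡ true → c i ≢ c j

HasClique : Graph → ℕ → Set
HasClique G k = Σ (Fin k → Fin (size G)) λ f →
  Injective _≡_ _≡_ f × (∀ a b → a ≢ b → adj G (f a) (f b) ≡ true)

CliqueAtMost : Graph → ℕ → Set
CliqueAtMost G n = ¬ HasClique G (suc n)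

CliqueNumber : Graph → ℕ → Set
CliqueNumber G w = HasClique G w × CliqueAtMost G w

Class : Set₁
Class = Graph → Set

_∩_ : Class → Class → Class
(C ∩ F) G = C G × F G

-- Polynomials with natural-number coefficients (constant term first)
Poly : Set
Poly = List ℕ

eval : Poly → ℕ → ℕ
eval [] x = 0
eval (a ∷ p) x = a + x * eval p x

PolyChiBounded : Class → Set
PolyChiBounded C = Σ Poly λ f → ∀ G → C G → ∀ G' → Embeds G' G →
  ∀ w → CliqueNumber G' w → Colorable G' (eval f w)

ClosedUnderInduced : Class → Set
ClosedUnderInduced F = ∀ G G' → F G → Embeds G' G → F G'

ChiNAtMost : ℕ → Graph → ℕ → Set
ChiNAtMost n G c = ∀ G' → Embeds G' G → CliqueAtMost G' n → Colorable G' c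

Good : ℕ → Class → Set
Good n F = ClosedUnderInduced F × Σ ℕ λ c → ∀ G → F G → ChiNAtMost n G c

StronglyPollyanna : ℕ → Class → Set₁
StronglyPollyanna n C = (F : Class) → Good n F → PolyChiBounded (C ∩ F)

-- Fix a maximum clique κ of G, of size ω.  Every vertex outside κ is classified by the
-- first t of its non-neighbours in κ, padded when it has fewer; this gives at most
-- (ω+1)^t classes.  In a padded class all vertices miss the same fewer than t clique
-- vertices, so a t-clique in the class together with the rest of κ would be a clique
-- larger than ω: the class has clique number below t and is c-colourable by goodness.
-- In a full class the t recorded clique vertices form a K_t anticomplete to the class,
-- so the class is H-free and f(ω)-colourable.  Giving κ and each class its own palette
-- of ω + f(ω) + c colours yields χ(G) ≤ (1 + (ω+1)^t) (ω + f(ω) + c).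
module Submission where

open import Defs
open import Data.Bool as Bool using (true; false)
open import Data.Empty using (⊥-elim)
open import Data.Fin using (Fin; zero; suc; splitAt; join; combine; inject≤; funToFin; finToFun)
open import Data.Fin.Properties as FinP using (any?; all?; suc-injective; join-splitAt; combine-injective; inject≤-injective; finToFun-funToFin)
open import Data.List as List using (List; []; _∷_; filter; allFin; length; lookup)
open import Data.List.Membership.Propositional using (_∈_)
open import Data.List.Membership.Propositional.Properties using (∈-filter⁺; ∈-filter⁻; ∈-allFin; ∈-lookup)
open import Data.List.Relation.Unary.All as All using (All)
open import Data.List.Relation.Unary.Any as Any using (here; there)
open import Data.List.Relation.Unary.Any.Properties using (lookup-index)
open import Data.List.Relation.Unary.AllPairs using (_∷_)
open import Data.List.Relation.Unary.Unique.Propositional using (Unique)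
import Data.List.Relation.Unary.Unique.Propositional.Properties as Unique
open import Data.Nat using (ℕ; zero; suc; _+_; _*_; _^_; _≤_; _∸_; z≤n)
open import Data.Nat.Properties using (≤-refl; ≤-trans; m≤n⇒m≤1+n; m≤m+n; m≤n+m; +-monoʳ-≤; *-mono-≤; +-identityʳ; *-zeroʳ; *-identityʳ)
open import Data.Nat.Tactic.RingSolver using (solve-∀)
open import Data.Product using (∃; _×_; _,_; proj₁; proj₂)
open import Data.Sum using (_⊎_; inj₁; inj₂; [_,_]′)
open import Function using (_∘_)
open import Function.Definitions using (Injective)
open import Level using (0ℓ)
open import Relation.Nullary using (¬_; Dec; yes; no)
open import Relation.Nullary.Decidable using (_→-dec_; ¬?)
open import Relation.Unary using (Pred; Decidable)
open import Relation.Binary.PropositionalEquality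
  using (_≡_; _≢_; refl; cong; cong₂; subst; subst₂; _≗_; module ≡-Reasoning)
  renaming (sym to ≡-sym; trans to ≡-trans)

Embeds-refl : ∀ {G} → Embeds G G
Embeds-refl = record { map = λ x → x ; inj = λ e → e ; presv = λ _ _ → refl }

Embeds-trans : ∀ {A B C} → Embeds A B → Embeds B C → Embeds A C
Embeds-trans e₁ e₂ = record
  { map   = Embeds.map e₂ ∘ Embeds.map e₁
  ; inj   = Embeds.inj e₁ ∘ Embeds.inj e₂
  ; presv = λ x y → ≡-trans (Embeds.presv e₁ x y) (Embeds.presv e₂ _ _)
  }

Free-closed : ∀ H → ClosedUnderInduced (Free H)
Free-closed H G G' free e e' = free (Embeds-trans e' e)

∩-closed : ∀ {C D} → ClosedUnderInduced C → ClosedUnderInduced D → ClosedUnderInduced (C ∩ D)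
∩-closed closedC closedD G G' (CG , DG) e = closedC G G' CG e , closedD G G' DG e

adj⇒≢ : ∀ G {u v} → adj G u v ≡ true → u ≢ v
adj⇒≢ G {u} a refl with ≡-trans (≡-sym (irrefl G u)) a
... | ()

AllAdjacent : ∀ (G : Graph) {k} → (Fin k → Fin (size G)) → Set
AllAdjacent G f = ∀ a b → a ≢ b → adj G (f a) (f b) ≡ true

allAdjacent⇒injective : ∀ G {k} {f : Fin k → Fin (size G)} → AllAdjacent G f → Injective _≡_ _≡_ f
allAdjacent⇒injective G {f = f} f-adj {a} {b} e with a FinP.≟ b
... | yes a≡b = a≡b
... | no a≢b = ⊥-elim (adj⇒≢ G (f-adj a b a≢b) e)

allAdjacent⇒hasClique : ∀ G {k} {f : Fin k → Fin (size G)} → AllAdjacent G f → HasClique G k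
allAdjacent⇒hasClique G f-adj = _ , allAdjacent⇒injective G f-adj , f-adj

allAdjacent? : ∀ G {k} (f : Fin k → Fin (size G)) → Dec (AllAdjacent G f)
allAdjacent? G f = all? λ a → all? λ b → ¬? (a FinP.≟ b) →-dec (adj G (f a) (f b) Bool.≟ true)

-- A clique Fin k → Fin n is searched for among the codes Fin (n ^ k) of all such maps.
hasClique? : ∀ G k → Dec (HasClique G k)
hasClique? G k with any? (λ x → allAdjacent? G (finToFun x))
... | yes (_ , f-adj) = yes (allAdjacent⇒hasClique G f-adj)
... | no none = no λ (f , _ , f-adj) → none (funToFin f , λ a b a≢b →
        subst₂ (λ x y → adj G x y ≡ true)
          (≡-sym (finToFun-funToFin f a)) (≡-sym (finToFun-funToFin f b)) (f-adj a b a≢b))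

hasClique-zero : ∀ G → HasClique G 0
hasClique-zero G = (λ ()) , (λ { {()} }) , λ ()

cliqueNumber-≤ : ∀ G m → CliqueAtMost G m → ∃ λ w → w ≤ m × CliqueNumber G w
cliqueNumber-≤ G zero ω≤0 = 0 , z≤n , hasClique-zero G , ω≤0
cliqueNumber-≤ G (suc m) ω≤m+1 with hasClique? G (suc m)
... | yes clique = suc m , ≤-refl , clique , ω≤m+1
... | no ω≤m with cliqueNumber-≤ G m ω≤m
...   | w , w≤m , ω≡w = w , m≤n⇒m≤1+n w≤m , ω≡w

hasClique-embeds : ∀ {A B k} → Embeds A B → HasClique A k → HasClique B k
hasClique-embeds e (f , f-inj , f-adj) =
  Embeds.map e ∘ f , f-inj ∘ Embeds.inj e ,
  λ a b a≢b → ≡-trans (≡-sym (Embeds.presv e (f a) (f b))) (f-adj a b a≢b)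

Colorable-mono : ∀ G {k k'} → k ≤ k' → Colorable G k → Colorable G k'
Colorable-mono G k≤k' (col , proper) =
  (λ x → inject≤ (col x) k≤k') ,
  λ x y a e → proper x y a (inject≤-injective k≤k' k≤k' _ _ e)

injective⇒colorable : ∀ G {k} (col : Fin (size G) → Fin k) → Injective _≡_ _≡_ col → Colorable G k
injective⇒colorable G col col-inj = col , λ x y a e → adj⇒≢ G a (col-inj e)

inhabited⊎empty : ∀ n → Fin n ⊎ ¬ Fin n
inhabited⊎empty zero = inj₂ λ ()
inhabited⊎empty (suc n) = inj₁ zero

colorable-of-vertex : ∀ G {k} → (Fin (size G) → Colorable G k) → Colorable G k
colorable-of-vertex G colorable with inhabited⊎empty (size G)
... | inj₁ x = colorable x
... | inj₂ empty = (λ x → ⊥-elim (empty x)) , λ x → ⊥-elim (empty x)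

lookup-injective : ∀ {A : Set} {xs : List A} → Unique xs → Injective _≡_ _≡_ (lookup xs)
lookup-injective {xs = _ ∷ _} (_ ∷ _) {zero} {zero} e = refl
lookup-injective {xs = _ ∷ _} (x∉ ∷ _) {zero} {suc j} e = ⊥-elim (All.lookup x∉ (∈-lookup j) e)
lookup-injective {xs = _ ∷ _} (x∉ ∷ _) {suc i} {zero} e = ⊥-elim (All.lookup x∉ (∈-lookup i) (≡-sym e))
lookup-injective {xs = _ ∷ _} (_ ∷ unique) {suc i} {suc j} e = cong suc (lookup-injective unique e)

module _ (G : Graph) {P : Pred (Fin (size G)) 0ℓ} (P? : Decidable P) where

  private
    members : List (Fin (size G))
    members = filter P? (allFin (size G))

  induced : Graph
  induced = record
    { size   = length members
    ; adj    = λ x y → adj G (lookup members x) (lookup members y)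
    ; sym    = λ x y → sym G (lookup members x) (lookup members y)
    ; irrefl = λ x → irrefl G (lookup members x)
    }

  inducedVertex : Fin (size induced) → Fin (size G)
  inducedVertex = lookup members

  induced-embeds : Embeds induced G
  induced-embeds = record
    { map   = inducedVertex
    ; inj   = lookup-injective (Unique.filter⁺ P? (Unique.allFin⁺ (size G)))
    ; presv = λ _ _ → refl
    }

  inducedVertex-satisfies : ∀ x → P (inducedVertex x)
  inducedVertex-satisfies x = proj₂ (∈-filter⁻ P? {xs = allFin (size G)} (∈-lookup x))

  inducedIndex : ∀ u → P u → Fin (size induced)
  inducedIndex u pu = Any.index (∈-filter⁺ P? (∈-allFin u) pu)

  inducedVertex-inducedIndex : ∀ u pu → inducedVertex (inducedIndex u pu) ≡ u
  inducedVertex-inducedIndex u pu = ≡-sym (lookup-index (∈-filter⁺ P? (∈-allFin u) pu))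

colorable-byParts : ∀ G {k m} (part : Fin (size G) → Fin k) →
  (∀ i → Colorable (induced G (λ v → part v FinP.≟ i)) m) → Colorable G (k * m)
colorable-byParts G {k} {m} part colorableᵢ = colour , proper
  where
  colourIn : ∀ i u → part u ≡ i → Fin m
  colourIn i u e = proj₁ (colorableᵢ i) (inducedIndex G (λ v → part v FinP.≟ i) u e)

  colour : Fin (size G) → Fin (k * m)
  colour u = combine (part u) (colourIn (part u) u refl)

  properIn : ∀ {i j} u v (eu : part u ≡ i) (ev : part v ≡ j) → i ≡ j →
             adj G u v ≡ true → colourIn i u eu ≢ colourIn j v ev
  properIn {i} u v eu ev refl a = proj₂ (colorableᵢ i) _ _
    (subst₂ (λ x y → adj G x y ≡ true)
      (≡-sym (inducedVertex-inducedIndex G P? u eu)) (≡-sym (inducedVertex-inducedIndex G P? v ev)) a)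
    where P? = λ v → part v FinP.≟ i

  proper : ∀ u v → adj G u v ≡ true → colour u ≢ colour v
  proper u v a e = let (same-part , same-colour) = combine-injective _ _ _ _ e
                   in properIn u v refl refl same-part a same-colour

infixl 6 _+ₚ_
infixl 7 _*ₚ_ _·ₚ_
infixr 8 _^ₚ_

const : ℕ → Poly
const c = c ∷ []

X : Poly
X = 0 ∷ 1 ∷ []

_+ₚ_ : Poly → Poly → Poly
[]      +ₚ q       = q
(a ∷ p) +ₚ []      = a ∷ p
(a ∷ p) +ₚ (b ∷ q) = a + b ∷ p +ₚ q

_·ₚ_ : ℕ → Poly → Poly
k ·ₚ p = List.map (k *_) p

_*ₚ_ : Poly → Poly → Poly
[]      *ₚ q = []
(a ∷ p) *ₚ q = a ·ₚ q +ₚ (0 ∷ p *ₚ q)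

_^ₚ_ : Poly → ℕ → Poly
p ^ₚ zero  = const 1
p ^ₚ suc n = p *ₚ p ^ₚ n

eval-const : ∀ c x → eval (const c) x ≡ c
eval-const c x rewrite *-zeroʳ x = +-identityʳ c

eval-X : ∀ x → eval X x ≡ x
eval-X x rewrite eval-const 1 x = *-identityʳ x

eval-+ₚ : ∀ p q x → eval (p +ₚ q) x ≡ eval p x + eval q x
eval-+ₚ []      q       x = refl
eval-+ₚ (a ∷ p) []      x = ≡-sym (+-identityʳ _)
eval-+ₚ (a ∷ p) (b ∷ q) x rewrite eval-+ₚ p q x = interchange a b x (eval p x) (eval q x)
  where
  interchange : ∀ a b x u v → a + b + x * (u + v) ≡ a + x * u + (b + x * v)
  interchange = solve-∀

eval-·ₚ : ∀ k p x → eval (k ·ₚ p) x ≡ k * eval p x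
eval-·ₚ k []      x = ≡-sym (*-zeroʳ k)
eval-·ₚ k (a ∷ p) x rewrite eval-·ₚ k p x = factor k a x (eval p x)
  where
  factor : ∀ k a x u → k * a + x * (k * u) ≡ k * (a + x * u)
  factor = solve-∀

eval-*ₚ : ∀ p q x → eval (p *ₚ q) x ≡ eval p x * eval q x
eval-*ₚ []      q x = refl
eval-*ₚ (a ∷ p) q x
  rewrite eval-+ₚ (a ·ₚ q) (0 ∷ p *ₚ q) x | eval-·ₚ a q x | eval-*ₚ p q x = factor a x (eval p x) (eval q x)
  where
  factor : ∀ a x u v → a * v + (0 + x * (u * v)) ≡ (a + x * u) * v
  factor = solve-∀

eval-^ₚ : ∀ p n x → eval (p ^ₚ n) x ≡ eval p x ^ n
eval-^ₚ p zero    x = eval-const 1 x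
eval-^ₚ p (suc n) x rewrite eval-*ₚ p (p ^ₚ n) x | eval-^ₚ p n x = refl

eval-mono : ∀ p {x y} → x ≤ y → eval p x ≤ eval p y
eval-mono []      x≤y = z≤n
eval-mono (a ∷ p) x≤y = +-monoʳ-≤ a (*-mono-≤ x≤y (eval-mono p x≤y))

polyChiBounded-of-closed : ∀ {C} (p : Poly) → ClosedUnderInduced C →
  (∀ G → C G → ∀ w → CliqueNumber G w → Colorable G (eval p w)) → PolyChiBounded C
polyChiBounded-of-closed p closed bound =
  p , λ G CG G' e w ω≡w → bound G' (closed G G' CG e) w ω≡w

-- The i-th entry of xs shifted by one, with 0 meaning that xs has fewer than i+1 entries.
paddedLookup : ∀ {w t} → List (Fin w) → Fin t → Fin (suc w)
paddedLookup []       _       = zero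
paddedLookup (x ∷ xs) zero    = suc x
paddedLookup (x ∷ xs) (suc i) = paddedLookup xs i

paddedLookup-∈ : ∀ {w t} (xs : List (Fin w)) (i : Fin t) {j} → paddedLookup xs i ≡ suc j → j ∈ xs
paddedLookup-∈ (x ∷ xs) zero    refl = here refl
paddedLookup-∈ (x ∷ xs) (suc i) e    = there (paddedLookup-∈ xs i e)

paddedLookup-injective : ∀ {w t} {xs : List (Fin w)} → Unique xs → ∀ (i i' : Fin t) {j} →
  paddedLookup xs i ≡ suc j → paddedLookup xs i' ≡ suc j → i ≡ i'
paddedLookup-injective {xs = x ∷ xs} _ zero zero _ _ = refl
paddedLookup-injective {xs = x ∷ xs} (x∉ ∷ _) zero (suc i') refl e' =
  ⊥-elim (All.lookup x∉ (paddedLookup-∈ xs i' e') refl)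
paddedLookup-injective {xs = x ∷ xs} (x∉ ∷ _) (suc i) zero e refl =
  ⊥-elim (All.lookup x∉ (paddedLookup-∈ xs i e) refl)
paddedLookup-injective {xs = x ∷ xs} (_ ∷ unique) (suc i) (suc i') e e' =
  cong suc (paddedLookup-injective unique i i' e e')

paddedLookup-complete : ∀ {w t} (xs : List (Fin w)) (p : Fin t) {j} →
  paddedLookup xs p ≡ zero → j ∈ xs → ∃ λ (i : Fin t) → paddedLookup xs i ≡ suc j
paddedLookup-complete (x ∷ xs) (suc p) _ (here refl) = zero , refl
paddedLookup-complete (x ∷ xs) (suc p) e (there j∈xs) =
  let (i , eᵢ) = paddedLookup-complete xs p e j∈xs in suc i , eᵢ

module CliquePartition (G : Graph) {w} (κ : Fin w → Fin (size G)) (κ-adj : AllAdjacent G κ) (t : ℕ) where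

  κ-injective : Injective _≡_ _≡_ κ
  κ-injective = allAdjacent⇒injective G κ-adj

  private
    nonAdjacent? : ∀ u → Decidable (λ j → adj G u (κ j) ≡ false)
    nonAdjacent? u j = adj G u (κ j) Bool.≟ false

  nonNeighbours : Fin (size G) → List (Fin w)
  nonNeighbours u = filter (nonAdjacent? u) (allFin w)

  nonNeighbours-unique : ∀ u → Unique (nonNeighbours u)
  nonNeighbours-unique u = Unique.filter⁺ (nonAdjacent? u) (Unique.allFin⁺ w)

  ∈-nonNeighbours⁺ : ∀ u j → adj G u (κ j) ≡ false → j ∈ nonNeighbours u
  ∈-nonNeighbours⁺ u j = ∈-filter⁺ (nonAdjacent? u) (∈-allFin j)

  ∈-nonNeighbours⁻ : ∀ u j → j ∈ nonNeighbours u → adj G u (κ j) ≡ false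
  ∈-nonNeighbours⁻ u j j∈ = proj₂ (∈-filter⁻ (nonAdjacent? u) {xs = allFin w} j∈)

  code : Fin (size G) → Fin t → Fin (suc w)
  code u = paddedLookup (nonNeighbours u)

  InClique : Fin (size G) → Set
  InClique u = ∃ λ j → κ j ≡ u

  inClique? : ∀ u → Dec (InClique u)
  inClique? u = any? λ j → κ j FinP.≟ u

  part : Fin (size G) → Fin (suc (suc w ^ t))
  part u with inClique? u
  ... | yes _ = zero
  ... | no _  = suc (funToFin (code u))

  part-inClique : ∀ {u} → InClique u → part u ≡ zero
  part-inClique {u} u∈κ with inClique? u
  ... | yes _ = refl
  ... | no u∉κ = ⊥-elim (u∉κ u∈κ)

  part≡zero⇒inClique : ∀ {u} → part u ≡ zero → InClique u
  part≡zero⇒inClique {u} e with inClique? u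
  ... | yes u∈κ = u∈κ

  samePart : ∀ {u v} → part v ≡ part u → ¬ InClique u → ¬ InClique v × code v ≗ code u
  samePart {u} {v} e u∉κ with inClique? v | inClique? u
  ... | _      | yes u∈κ = ⊥-elim (u∉κ u∈κ)
  ... | no v∉κ | no _    = v∉κ , λ i → begin
    code v i                           ≡⟨ finToFun-funToFin (code v) i ⟨
    finToFun (funToFin (code v)) i     ≡⟨ cong (λ x → finToFun x i) (suc-injective e) ⟩
    finToFun (funToFin (code u)) i     ≡⟨ finToFun-funToFin (code u) i ⟩
    code u i                           ∎
    where open ≡-Reasoning

  -- The first τ-slot that is padding shows that τ lists all non-neighbours, so Q misses
  -- at most t − 1 clique vertices; replacing them by Q gives ω + 1 pairwise adjacent vertices.
  padded⇒largerClique : (τ : Fin t → Fin (suc w)) (p : Fin t) → τ p ≡ zero →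
    (Q : Fin t → Fin (size G)) → AllAdjacent G Q → (∀ a → code (Q a) ≗ τ) → HasClique G (suc w)
  padded⇒largerClique τ p τp≡0 Q Q-adj Q-code = allAdjacent⇒hasClique G g-adj
    where
    Listed : Fin (suc w) → Set
    Listed a = ∃ λ i → τ i ≡ a

    unlisted : ∀ a → ¬ Listed a → Fin w
    unlisted zero    a∉τ = ⊥-elim (a∉τ (p , τp≡0))
    unlisted (suc j) _   = j

    suc-unlisted : ∀ a a∉τ → suc (unlisted a a∉τ) ≡ a
    suc-unlisted zero    a∉τ = ⊥-elim (a∉τ (p , τp≡0))
    suc-unlisted (suc j) _   = refl

    Q-κ-adj : ∀ a j → ¬ Listed (suc j) → adj G (Q a) (κ j) ≡ true
    Q-κ-adj a j j∉τ with adj G (Q a) (κ j) in e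
    ... | true  = refl
    ... | false =
      let (i , eᵢ) = paddedLookup-complete (nonNeighbours (Q a)) p
                       (≡-trans (Q-code a p) τp≡0) (∈-nonNeighbours⁺ (Q a) j e)
      in ⊥-elim (j∉τ (i , ≡-trans (≡-sym (Q-code a i)) eᵢ))

    g : Fin (suc w) → Fin (size G)
    g a with any? (λ i → τ i FinP.≟ a)
    ... | yes (i , _) = Q i
    ... | no a∉τ      = κ (unlisted a a∉τ)

    g-adj : AllAdjacent G g
    g-adj a b a≢b with any? (λ i → τ i FinP.≟ a) | any? (λ i → τ i FinP.≟ b)
    ... | yes (i , refl) | yes (i' , refl) = Q-adj i i' λ { refl → a≢b refl }
    ... | yes (i , _) | no b∉τ =
      Q-κ-adj i _ (subst (¬_ ∘ Listed) (≡-sym (suc-unlisted b b∉τ)) b∉τ)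
    ... | no a∉τ | yes (i , _) =
      ≡-trans (sym G _ (Q i)) (Q-κ-adj i _ (subst (¬_ ∘ Listed) (≡-sym (suc-unlisted a a∉τ)) a∉τ))
    ... | no a∉τ | no b∉τ = κ-adj _ _ λ j≡j' →
      a≢b (≡-trans (≡-sym (suc-unlisted a a∉τ)) (≡-trans (cong suc j≡j') (suc-unlisted b b∉τ)))

  -- The clique vertices recorded in a full code form a K_t that the whole part misses.
  full⇒embedsKt∪ : ∀ H (u₀ : Fin (size G)) → (∀ i → ∃ λ j → code u₀ i ≡ suc j) →
    (e : Embeds H G) → (∀ h → ¬ InClique (Embeds.map e h)) → (∀ h → code (Embeds.map e h) ≗ code u₀) →
    Embeds (K t ∪G H) G
  full⇒embedsKt∪ H u₀ full e outside sameCode = record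
    { map = ψ ; inj = ψ-injective ; presv = ψ-presv }
    where
    m = Embeds.map e

    listed : Fin t → Fin w
    listed a = proj₁ (full a)

    listed-injective : Injective _≡_ _≡_ listed
    listed-injective {a} {b} eq =
      paddedLookup-injective (nonNeighbours-unique u₀) a b
        (≡-trans (proj₂ (full a)) (cong suc eq)) (proj₂ (full b))

    x : Fin t → Fin (size G)
    x = κ ∘ listed

    x-adj : ∀ a b → K-adj t a b ≡ adj G (x a) (x b)
    x-adj a b with a FinP.≟ b
    ... | yes refl = ≡-sym (irrefl G (x a))
    ... | no a≢b   = ≡-sym (κ-adj _ _ (a≢b ∘ listed-injective))

    m-x-nonadj : ∀ h a → adj G (m h) (x a) ≡ false
    m-x-nonadj h a = ∈-nonNeighbours⁻ (m h) (listed a)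
      (paddedLookup-∈ _ a (≡-trans (sameCode h a) (proj₂ (full a))))

    ψ′ : Fin t ⊎ Fin (size H) → Fin (size G)
    ψ′ = [ x , m ]′

    ψ : Fin (t + size H) → Fin (size G)
    ψ = ψ′ ∘ splitAt t

    ψ′-injective : Injective _≡_ _≡_ ψ′
    ψ′-injective {inj₁ a} {inj₁ b} eq = cong inj₁ (listed-injective (κ-injective eq))
    ψ′-injective {inj₁ a} {inj₂ h} eq = ⊥-elim (outside h (listed a , eq))
    ψ′-injective {inj₂ h} {inj₁ a} eq = ⊥-elim (outside h (listed a , ≡-sym eq))
    ψ′-injective {inj₂ h} {inj₂ h'} eq = cong inj₂ (Embeds.inj e eq)

    ψ-injective : Injective _≡_ _≡_ ψ
    ψ-injective {i} {j} eq = begin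
      i                        ≡⟨ join-splitAt t _ i ⟨
      join t _ (splitAt t i)   ≡⟨ cong (join t _) (ψ′-injective {splitAt t i} {splitAt t j} eq) ⟩
      join t _ (splitAt t j)   ≡⟨ join-splitAt t _ j ⟩
      j                        ∎
      where open ≡-Reasoning

    ψ-presv : ∀ i j → adj (K t ∪G H) i j ≡ adj G (ψ i) (ψ j)
    ψ-presv i j with splitAt t i | splitAt t j
    ... | inj₁ a | inj₁ b  = x-adj a b
    ... | inj₂ h | inj₂ h' = Embeds.presv e h h'
    ... | inj₁ a | inj₂ h  = ≡-sym (≡-trans (sym G (x a) (m h)) (m-x-nonadj h a))
    ... | inj₂ h | inj₁ a  = ≡-sym (m-x-nonadj h a)

module Colouring
  (t' : ℕ) (H : Graph) (F : Class) (closedF : ClosedUnderInduced F)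
  (c : ℕ) (f : Poly) (fbound : ∀ G → (Free H ∩ F) G → ∀ G' → Embeds G' G → ∀ w → CliqueNumber G' w → Colorable G' (eval f w))
  (G : Graph) (G-free : Free (K (suc t') ∪G H) G) (FG : F G) (G-χ≤c : ChiNAtMost t' G c)
  {w} (κ : Fin w → Fin (size G)) (κ-adj : AllAdjacent G κ) (ω≤w : CliqueAtMost G w)
  where

  open CliquePartition G κ κ-adj (suc t')

  Part : Fin (suc (suc w ^ suc t')) → Graph
  Part i = induced G (λ v → part v FinP.≟ i)

  vertex : ∀ {i} → Fin (size (Part i)) → Fin (size G)
  vertex {i} = inducedVertex G (λ v → part v FinP.≟ i)

  vertex-part : ∀ {i} (x : Fin (size (Part i))) → part (vertex x) ≡ i
  vertex-part {i} = inducedVertex-satisfies G (λ v → part v FinP.≟ i)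

  Part-embeds : ∀ i → Embeds (Part i) G
  Part-embeds i = induced-embeds G (λ v → part v FinP.≟ i)

  cliquePart-colorable : ∀ i → i ≡ zero → Colorable (Part i) w
  cliquePart-colorable i refl = injective⇒colorable (Part zero) colour λ {x} {y} e →
    Embeds.inj (Part-embeds zero)
      (≡-trans (≡-sym (proj₂ (inClique x))) (≡-trans (cong κ e) (proj₂ (inClique y))))
    where
    inClique : ∀ x → InClique (vertex {zero} x)
    inClique x = part≡zero⇒inClique (vertex-part x)

    colour : Fin (size (Part zero)) → Fin w
    colour = proj₁ ∘ inClique

  paddedPart-colorable : ∀ i u → part u ≡ i → ¬ InClique u → ∀ p → code u p ≡ zero → Colorable (Part i) c
  paddedPart-colorable i u u∈i u∉κ p pad = G-χ≤c (Part i) (Part-embeds i) λ (q , _ , q-adj) →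
    ω≤w (padded⇒largerClique (code u) p pad (vertex ∘ q) q-adj
          λ a → proj₂ (samePart (≡-trans (vertex-part (q a)) (≡-sym u∈i)) u∉κ))

  fullPart-colorable : ∀ i u → part u ≡ i → ¬ InClique u → (∀ p → ∃ λ j → code u p ≡ suc j) →
    Colorable (Part i) (eval f w)
  fullPart-colorable i u u∈i u∉κ full =
    let (w' , w'≤w , ω≡w') = cliqueNumber-≤ (Part i) w (ω≤w ∘ hasClique-embeds (Part-embeds i))
    in Colorable-mono (Part i) (eval-mono f w'≤w)
         (fbound (Part i) (H-free , closedF G (Part i) FG (Part-embeds i)) (Part i) Embeds-refl w' ω≡w')
    where
    H-free : Free H (Part i)
    H-free e = G-free (full⇒embedsKt∪ H u full (Embeds-trans e (Part-embeds i))
      (λ h → proj₁ (same h)) (λ h → proj₂ (same h)))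
      where
      same : ∀ h → ¬ InClique (vertex (Embeds.map e h)) × code (vertex (Embeds.map e h)) ≗ code u
      same h = samePart (≡-trans (vertex-part (Embeds.map e h)) (≡-sym u∈i)) u∉κ

  part-colorable : ∀ i → Colorable (Part i) (w + (eval f w + c))
  part-colorable i = colorable-of-vertex (Part i) λ x → from-vertex (vertex x) (vertex-part x) (inClique? (vertex x))
    where
    from-vertex : ∀ u → part u ≡ i → Dec (InClique u) → Colorable (Part i) (w + (eval f w + c))
    from-vertex u u∈i (yes u∈κ) = Colorable-mono (Part i) (m≤m+n w _)
                                    (cliquePart-colorable i (≡-trans (≡-sym u∈i) (part-inClique u∈κ)))
    from-vertex u u∈i (no u∉κ) with any? (λ p → code u p FinP.≟ zero)
    ...   | yes (p , pad) = Colorable-mono (Part i) (≤-trans (m≤n+m c (eval f w)) (m≤n+m _ w))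
                              (paddedPart-colorable i u u∈i u∉κ p pad)
    ...   | no unpadded = Colorable-mono (Part i) (≤-trans (m≤m+n (eval f w) c) (m≤n+m _ w))
                              (fullPart-colorable i u u∈i u∉κ (filled ∘ unpadded′))
      where
      unpadded′ : ∀ p → code u p ≢ zero
      unpadded′ p pad = unpadded (p , pad)

      filled : ∀ {p} → code u p ≢ zero → ∃ λ j → code u p ≡ suc j
      filled {p} ne with code u p
      ... | zero  = ⊥-elim (ne refl)
      ... | suc j = j , refl

  colorable : Colorable G (suc (suc w ^ suc t') * (w + (eval f w + c)))
  colorable = colorable-byParts G part part-colorable

χ-bound : ℕ → ℕ → Poly → Poly
χ-bound t c f = (const 1 +ₚ (const 1 +ₚ X) ^ₚ t) *ₚ (X +ₚ (f +ₚ const c))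

eval-χ-bound : ∀ t c f w → eval (χ-bound t c f) w ≡ suc (suc w ^ t) * (w + (eval f w + c))
eval-χ-bound t c f w = begin
  eval (χ-bound t c f) w
    ≡⟨ eval-*ₚ (const 1 +ₚ (const 1 +ₚ X) ^ₚ t) (X +ₚ (f +ₚ const c)) w ⟩
  eval (const 1 +ₚ (const 1 +ₚ X) ^ₚ t) w * eval (X +ₚ (f +ₚ const c)) w
    ≡⟨ cong₂ _*_ (≡-trans (eval-+ₚ (const 1) ((const 1 +ₚ X) ^ₚ t) w) (cong₂ _+_ (eval-const 1 w) count))
                 (≡-trans (eval-+ₚ X (f +ₚ const c) w) (cong₂ _+_ (eval-X w)
                   (≡-trans (eval-+ₚ f (const c) w) (cong (eval f w +_) (eval-const c w))))) ⟩
  suc (suc w ^ t) * (w + (eval f w + c))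
    ∎
  where
  open ≡-Reasoning
  count : eval ((const 1 +ₚ X) ^ₚ t) w ≡ suc w ^ t
  count = ≡-trans (eval-^ₚ (const 1 +ₚ X) t w)
            (cong (_^ t) (≡-trans (eval-+ₚ (const 1) X w) (cong₂ _+_ (eval-const 1 w) (eval-X w))))

proposition3p2 : (t : ℕ) → 1 ≤ t → (H : Graph) →
    StronglyPollyanna (t ∸ 1) (Free H) →
    StronglyPollyanna (t ∸ 1) (Free (K t ∪G H))
proposition3p2 (suc t') _ H pollyanna F good@(closedF , c , χ≤c) =
  let (f , fbound) = pollyanna F good in
  polyChiBounded-of-closed (χ-bound (suc t') c f) (∩-closed (Free-closed _) closedF)
    λ { G (G-free , FG) w ((κ , _ , κ-adj) , ω≤w) →
          subst (Colorable G) (≡-sym (eval-χ-bound (suc t') c f w))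
            (Colouring.colorable t' H F closedF c f fbound G G-free FG (χ≤c G FG) κ κ-adj ω≤w) }
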